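{- For all $n>2$, $\det'(K_n)=\lfloor 2n/3\rfloor$.
   Context: $K_n$ is the complete graph on $n$ vertices. For a graph with at most one isolated vertex and no $K_2$ component, an edge set $T$ is an edge determining set if the only automorphism $\phi$ with $\{\phi(u),\phi(v)\}=\{u,v\}$ for all $\{u,v\}\in T$ is the identity; $\det'(G)$ is the minimum size of such a set. -}

module Defs where

open import Level using (0ℓ)
open import Data.Nat using (ℕ; _≤_)
open import Data.Fin using (Fin; _<_)
open import Data.Fin.Permutation using (Permutation′; _⟨$⟩ʳ_)
open import Data.Product using (Σ; Σ-syntax; _×_; _,_; proj₁)
open import Data.Sum using (_⊎_)
open import Data.List using (List; length; map)
open import Data.List.Membership.Propositional using (_∈_)
open import Data.List.Relation.Unary.Unique.Propositional using (Unique)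
open import Relation.Binary.PropositionalEquality using (_≡_; _≢_)
open import Function.Bundles using (_⇔_)

record Graph (n : ℕ) : Set₁ where
  field
    Adj : Fin n → Fin n → Set

K : (n : ℕ) → Graph n
K n = record { Adj = λ u v → u ≢ v }

IsAutomorphism : ∀ {n} → Graph n → Permutation′ n → Set
IsAutomorphism {n} G φ = ∀ (u v : Fin n) → Adj u v ⇔ Adj (φ ⟨$⟩ʳ u) (φ ⟨$⟩ʳ v)
  where open Graph G

Edge : ∀ {n} → Graph n → Set
Edge {n} G = Σ[ u ∈ Fin n ] Σ[ v ∈ Fin n ] (u < v × Graph.Adj G u v)

endpoints : ∀ {n} {G : Graph n} → Edge G → Fin n × Fin n
endpoints (u , v , _) = (u , v)

FixesEdge : ∀ {n} {G : Graph n} → Permutation′ n → Edge G → Set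
FixesEdge φ (u , v , _) =
  ((φ ⟨$⟩ʳ u) ≡ u × (φ ⟨$⟩ʳ v) ≡ v) ⊎ ((φ ⟨$⟩ʳ u) ≡ v × (φ ⟨$⟩ʳ v) ≡ u)

IsEdgeDeterminingSet : ∀ {n} (G : Graph n) → List (Edge G) → Set
IsEdgeDeterminingSet {n} G T =
  ∀ (φ : Permutation′ n) → IsAutomorphism G φ →
    (∀ e → e ∈ T → FixesEdge {G = G} φ e) →
    ∀ (x : Fin n) → (φ ⟨$⟩ʳ x) ≡ x

EdgeSet : ∀ {n} → Graph n → Set
EdgeSet G = Σ[ T ∈ List (Edge G) ] Unique (map (endpoints {G = G}) T)

Det′ : ∀ {n} → Graph n → ℕ → Set
Det′ G k =
  (Σ[ T ∈ EdgeSet G ] (IsEdgeDeterminingSet G (proj₁ T) × length (proj₁ T) ≡ k))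
  × (∀ (T : EdgeSet G) → IsEdgeDeterminingSet G (proj₁ T) → k ≤ length (proj₁ T))

-- Every permutation is an automorphism of Kₙ, so no transposition (v w) with v ≢ w
-- may fix every edge of a determining set T. Lower bound: hence at most one vertex
-- meets no edge of T, and no edge of T has two endpoints of degree one. Each vertex
-- can therefore be given two private tokens: a vertex of degree ≥ 2 uses two of its
-- edge-endpoint slots, a vertex of degree 1 its slot plus the unique "leaf" slot of
-- its edge, the isolated vertex two spare tokens; this injects 2n into 3|T| + 2, so
-- ⌊2n/3⌋ ≤ |T|.
-- Upper bound: cut the vertices into consecutive triples and take the path a–b–c on
-- each (with an extra pendant edge when n ≡ 2 mod 3). An automorphism fixing these
-- edges setwise fixes every vertex but the last, hence the last one too.
module Submission where

open import Defs
open import Data.Nat using (ℕ; _<_; _*_; _/_; suc; _+_; _≤_; s≤s)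
import Data.Nat.Properties as ℕ
open import Data.Nat.DivMod using (m<n*o⇒m/o<n; /-congˡ; +-distrib-/-∣ˡ)
open import Data.Nat.Divisibility using (divides)
open import Data.Fin using (Fin; suc; fromℕ; _≟_)
open import Data.Fin.Patterns using (0F; 1F; 2F; 3F; 4F)
open import Data.Fin.Properties using (any?; _<?_; *↔×; +↔⊎; injective⇒≤; suc-injective; <⇒≢)
open import Data.Fin.Permutation using (Permutation′; _⟨$⟩ʳ_; transpose)
import Data.Fin.Permutation.Components as PC
open import Data.Product using (∃-syntax; _×_; _,_; proj₁; proj₂)
open import Data.Product.Function.NonDependent.Propositional using (_×-↔_)
open import Data.Sum using (_⊎_; inj₁; inj₂; [_,_]′)
open import Data.Sum.Function.Propositional using (_⊎-↔_)
open import Data.Empty using (⊥-elim)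
open import Data.List using (List; []; _∷_; length; map; lookup)
open import Data.List.Properties using (length-map; map-∘)
open import Data.List.Membership.Propositional using (_∈_)
open import Data.List.Membership.Propositional.Properties using (∈-map⁺)
open import Data.List.Relation.Unary.Any using (here; there; index)
open import Data.List.Relation.Unary.Any.Properties using (lookup-index)
open import Data.List.Relation.Unary.All using (All; universal; []; _∷_)
open import Data.List.Relation.Unary.All.Properties using ()
  renaming (map⁺ to All-map⁺)
open import Data.List.Relation.Unary.AllPairs using ([]; _∷_)
open import Data.List.Relation.Unary.Unique.Propositional using (Unique)
open import Data.List.Relation.Unary.Unique.Propositional.Properties using ()
  renaming (map⁺ to Unique-map⁺)
open import Function using (_∘_; id)
open import Function.Bundles using (_↔_; _↣_; mk↣; mk⇔; Injection)
open import Function.Definitions using (Injective)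
open import Function.Properties.Inverse using (↔-refl; ↔-sym; ↔⇒↣)
open import Function.Construct.Composition using (_↣-∘_; _↔-∘_)
open import Relation.Binary.PropositionalEquality
open import Relation.Nullary using (¬_; yes; no; contraposition)
open import Relation.Nullary.Decidable using (True; toWitness; fromWitness)
open import Relation.Unary using (Decidable)

⟨$⟩ʳ-injective : ∀ {n} (φ : Permutation′ n) → Injective _≡_ _≡_ (φ ⟨$⟩ʳ_)
⟨$⟩ʳ-injective φ = Injection.injective (↔⇒↣ φ)

permutation-isAutomorphism : ∀ {n} (φ : Permutation′ n) → IsAutomorphism (K n) φ
permutation-isAutomorphism φ u v =
  mk⇔ (contraposition (⟨$⟩ʳ-injective φ)) (contraposition (cong (φ ⟨$⟩ʳ_)))

fixed-everywhere : ∀ {n} (φ : Permutation′ n) z →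
                   (∀ x → x ≢ z → φ ⟨$⟩ʳ x ≡ x) → ∀ x → φ ⟨$⟩ʳ x ≡ x
fixed-everywhere φ z fixed x with x ≟ z
... | no x≢z = fixed x x≢z
... | yes refl with φ ⟨$⟩ʳ x ≟ x
...   | yes φx≡x = φx≡x
...   | no φx≢x = ⊥-elim (φx≢x (⟨$⟩ʳ-injective φ (fixed (φ ⟨$⟩ʳ x) φx≢x)))

transpose-matchˡ : ∀ {n} (i j : Fin n) → PC.transpose i j i ≡ j
transpose-matchˡ i j with i ≟ i
... | yes _ = refl
... | no i≢i = ⊥-elim (i≢i refl)

transpose-matchʳ : ∀ {n} (i j : Fin n) → PC.transpose i j j ≡ i
transpose-matchʳ i j with j ≟ i
... | yes j≡i = j≡i
... | no _ with j ≟ j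
...   | yes _ = refl
...   | no j≢j = ⊥-elim (j≢j refl)

transpose-mismatch : ∀ {n} {i j k : Fin n} → k ≢ i → k ≢ j → PC.transpose i j k ≡ k
transpose-mismatch {i = i} {j} {k} k≢i k≢j with k ≟ i
... | yes k≡i = ⊥-elim (k≢i k≡i)
... | no _ with k ≟ j
...   | yes k≡j = ⊥-elim (k≢j k≡j)
...   | no _ = refl

FixesPair : ∀ {n} → (Fin n → Fin n) → Fin n → Fin n → Set
FixesPair f a b = (f a ≡ a × f b ≡ b) ⊎ (f a ≡ b × f b ≡ a)

module _ {n} {f : Fin n → Fin n} where

  fixesPair-middle : ∀ {a b c} → a ≢ c → FixesPair f a b → FixesPair f b c → f b ≡ b
  fixesPair-middle _ (inj₁ (_ , fb≡b)) _ = fb≡b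
  fixesPair-middle _ (inj₂ _) (inj₁ (fb≡b , _)) = fb≡b
  fixesPair-middle a≢c (inj₂ (_ , fb≡a)) (inj₂ (fb≡c , _)) = ⊥-elim (a≢c (trans (sym fb≡a) fb≡c))

  fixesPair-left : ∀ {a b} → a ≢ b → FixesPair f a b → f b ≡ b → f a ≡ a
  fixesPair-left _ (inj₁ (fa≡a , _)) _ = fa≡a
  fixesPair-left a≢b (inj₂ (_ , fb≡a)) fb≡b = ⊥-elim (a≢b (trans (sym fb≡a) fb≡b))

  fixesPair-right : ∀ {a b} → a ≢ b → FixesPair f a b → f a ≡ a → f b ≡ b
  fixesPair-right _ (inj₁ (_ , fb≡b)) _ = fb≡b
  fixesPair-right a≢b (inj₂ (fa≡b , _)) fa≡a = ⊥-elim (a≢b (trans (sym fa≡a) fa≡b))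

  path-fixed : ∀ {a b c} → a ≢ b → b ≢ c → a ≢ c → FixesPair f a b → FixesPair f b c →
               f a ≡ a × f b ≡ b × f c ≡ c
  path-fixed a≢b b≢c a≢c ab bc =
    fixesPair-left a≢b ab fb≡b , fb≡b , fixesPair-right b≢c bc fb≡b
    where fb≡b = fixesPair-middle a≢c ab bc

data Multiplicity {t} (P : Fin t → Set) : Set where
  none  : (∀ e → ¬ P e) → Multiplicity P
  once  : ∀ e → P e → (∀ e′ → P e′ → e′ ≡ e) → Multiplicity P
  twice : ∀ e₁ e₂ → e₁ ≢ e₂ → P e₁ → P e₂ → Multiplicity P

multiplicity : ∀ {t} {P : Fin t → Set} → Decidable P → Multiplicity P
multiplicity {t = 0} P? = none λ ()
multiplicity {t = suc t} P? with multiplicity (P? ∘ suc) | P? 0F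
... | none ¬P | no ¬P0 = none λ { 0F → ¬P0 ; (suc e) → ¬P e }
... | none ¬P | yes P0 = once 0F P0 λ { 0F _ → refl ; (suc e) Pe → ⊥-elim (¬P e Pe) }
... | once e Pe only | no ¬P0 =
  once (suc e) Pe λ { 0F P0 → ⊥-elim (¬P0 P0) ; (suc e′) Pe′ → cong suc (only e′ Pe′) }
... | once e Pe _ | yes P0 = twice 0F (suc e) (λ ()) P0 Pe
... | twice e₁ e₂ e₁≢e₂ P₁ P₂ | _ = twice (suc e₁) (suc e₂) (e₁≢e₂ ∘ suc-injective) P₁ P₂

m≤t*3+2⇒m/3≤t : ∀ {m} t → m ≤ t * 3 + 2 → m / 3 ≤ t
m≤t*3+2⇒m/3≤t {m} t m≤ = ℕ.≤-pred (m<n*o⇒m/o<n (begin-strict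
  m             ≤⟨ m≤ ⟩
  t * 3 + 2     <⟨ ℕ.+-monoʳ-< (t * 3) (ℕ.n<1+n 2) ⟩
  t * 3 + 3     ≡⟨ ℕ.+-comm (t * 3) 3 ⟩
  suc t * 3     ∎))
  where open ℕ.≤-Reasoning

module LowerBound {n} (T : List (Edge (K n))) (T-determining : IsEdgeDeterminingSet (K n) T) where

  t : ℕ
  t = length T

  end : Fin t → Fin 2 → Fin n
  end e 0F = proj₁ (lookup T e)
  end e 1F = proj₁ (proj₂ (lookup T e))

  Incident : Fin n → Fin t → Set
  Incident v e = ∃[ p ] end e p ≡ v

  incident? : ∀ v → Decidable (Incident v)
  incident? v e = any? λ p → end e p ≟ v

  Fixes : Permutation′ n → Fin t → Set
  Fixes φ e = FixesPair (φ ⟨$⟩ʳ_) (end e 0F) (end e 1F)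

  swappable⇒≡ : ∀ {v w} → (∀ e → Incident v e ⊎ Incident w e → Fixes (transpose v w) e) → v ≡ w
  swappable⇒≡ {v} {w} fixes-incident =
    trans (sym (T-determining τ (permutation-isAutomorphism τ) fixes-T v)) (transpose-matchˡ v w)
    where
    τ = transpose v w
    fixes : ∀ e → Fixes τ e
    fixes e with incident? v e | incident? w e
    ... | yes v∈e | _ = fixes-incident e (inj₁ v∈e)
    ... | no _ | yes w∈e = fixes-incident e (inj₂ w∈e)
    ... | no v∉e | no w∉e =
      inj₁ (transpose-mismatch (v∉e ∘ (0F ,_)) (w∉e ∘ (0F ,_)) ,
            transpose-mismatch (v∉e ∘ (1F ,_)) (w∉e ∘ (1F ,_)))
    fixes-T : ∀ e → e ∈ T → FixesEdge {G = K n} τ e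
    fixes-T e e∈T = subst (FixesEdge {G = K n} τ) (sym (lookup-index e∈T)) (fixes (index e∈T))

  isolated-unique : ∀ {v w} → (∀ e → ¬ Incident v e) → (∀ e → ¬ Incident w e) → v ≡ w
  isolated-unique v∉ w∉ = swappable⇒≡ λ e → [ ⊥-elim ∘ v∉ e , ⊥-elim ∘ w∉ e ]′

  sole-edge⇒≡ : ∀ {v w e} → (∀ e′ → Incident v e′ ⊎ Incident w e′ → e′ ≡ e) →
                Fixes (transpose v w) e → v ≡ w
  sole-edge⇒≡ {v} {w} only fixes-e =
    swappable⇒≡ λ e′ inc → subst (Fixes (transpose v w)) (sym (only e′ inc)) fixes-e

  leaves-equal : ∀ {v w e} → (∀ e′ → Incident v e′ → e′ ≡ e) → (∀ e′ → Incident w e′ → e′ ≡ e) →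
                 Incident v e → Incident w e → v ≡ w
  leaves-equal _ _ (0F , v≡) (0F , w≡) = trans (sym v≡) w≡
  leaves-equal _ _ (1F , v≡) (1F , w≡) = trans (sym v≡) w≡
  leaves-equal {e = e} only-v only-w (0F , refl) (1F , refl) =
    sole-edge⇒≡ (λ e′ → [ only-v e′ , only-w e′ ]′)
      (inj₂ (transpose-matchˡ (end e 0F) (end e 1F) , transpose-matchʳ (end e 0F) (end e 1F)))
  leaves-equal {e = e} only-v only-w (1F , refl) (0F , refl) =
    sole-edge⇒≡ (λ e′ → [ only-v e′ , only-w e′ ]′)
      (inj₂ (transpose-matchʳ (end e 1F) (end e 0F) , transpose-matchˡ (end e 1F) (end e 0F)))

  -- Token slots: for each edge its two endpoints and one leaf slot, plus two spares.
  Token : Set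
  Token = (Fin t × (Fin 2 ⊎ Fin 1)) ⊎ Fin 2

  Token↔Fin : Token ↔ Fin (t * 3 + 2)
  Token↔Fin = ↔-sym (((↔-refl ×-↔ +↔⊎) ↔-∘ *↔× ⊎-↔ ↔-refl) ↔-∘ +↔⊎)

  data Owns (v : Fin n) : Token → Set where
    isolated : (∀ e → ¬ Incident v e) → ∀ i → Owns v (inj₂ i)
    endpoint : ∀ e p → end e p ≡ v → Owns v (inj₁ (e , inj₁ p))
    leaf     : ∀ e → Incident v e → (∀ e′ → Incident v e′ → e′ ≡ e) → Owns v (inj₁ (e , inj₂ 0F))

  owner-unique : ∀ {v w x} → Owns v x → Owns w x → v ≡ w
  owner-unique (isolated v∉ _) (isolated w∉ _) = isolated-unique v∉ w∉
  owner-unique (endpoint _ _ v≡) (endpoint _ _ w≡) = trans (sym v≡) w≡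
  owner-unique (leaf _ v∈ only-v) (leaf _ w∈ only-w) = leaves-equal only-v only-w v∈ w∈

  token : ∀ v → Multiplicity (Incident v) → Fin 2 → Token
  token v (none _) i = inj₂ i
  token v (once e (p , _) _) 0F = inj₁ (e , inj₁ p)
  token v (once e _ _) 1F = inj₁ (e , inj₂ 0F)
  token v (twice e₁ _ _ (p₁ , _) _) 0F = inj₁ (e₁ , inj₁ p₁)
  token v (twice _ e₂ _ _ (p₂ , _)) 1F = inj₁ (e₂ , inj₁ p₂)

  token-owned : ∀ v m i → Owns v (token v m i)
  token-owned v (none v∉) i = isolated v∉ i
  token-owned v (once e (p , v≡) _) 0F = endpoint e p v≡
  token-owned v (once e v∈e only) 1F = leaf e v∈e only
  token-owned v (twice e₁ _ _ (p₁ , v≡) _) 0F = endpoint e₁ p₁ v≡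
  token-owned v (twice _ e₂ _ _ (p₂ , v≡)) 1F = endpoint e₂ p₂ v≡

  token-injective : ∀ v m {i j} → token v m i ≡ token v m j → i ≡ j
  token-injective v (none _) refl = refl
  token-injective v (once _ _ _) {0F} {0F} _ = refl
  token-injective v (once _ _ _) {1F} {1F} _ = refl
  token-injective v (once _ _ _) {0F} {1F} ()
  token-injective v (once _ _ _) {1F} {0F} ()
  token-injective v (twice _ _ _ _ _) {0F} {0F} _ = refl
  token-injective v (twice _ _ _ _ _) {1F} {1F} _ = refl
  token-injective v (twice _ _ e₁≢e₂ _ _) {0F} {1F} refl = ⊥-elim (e₁≢e₂ refl)
  token-injective v (twice _ _ e₁≢e₂ _ _) {1F} {0F} refl = ⊥-elim (e₁≢e₂ refl)

  vertexToken : Fin n × Fin 2 → Token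
  vertexToken (v , i) = token v (multiplicity (incident? v)) i

  vertexToken-injective : Injective _≡_ _≡_ vertexToken
  vertexToken-injective {v , i} {w , j} eq
    with owner-unique (token-owned v _ i) (subst (Owns w) (sym eq) (token-owned w _ j))
  ... | refl = cong (v ,_) (token-injective v _ eq)

  2n≤3t+2 : n * 2 ≤ t * 3 + 2
  2n≤3t+2 = injective⇒≤ (Injection.injective
    (↔⇒↣ Token↔Fin ↣-∘ (mk↣ vertexToken-injective ↣-∘ ↔⇒↣ *↔×)))

  size-bound : (2 * n) / 3 ≤ t
  size-bound = m≤t*3+2⇒m/3≤t t (subst (_≤ t * 3 + 2) (ℕ.*-comm n 2) 2n≤3t+2)

infix 6 _—_
_—_ : ∀ {n} (a b : Fin n) {a<b : True (a <? b)} → Edge (K n)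
(a — b) {a<b} = a , b , toWitness a<b , <⇒≢ (toWitness a<b)

suc³ : ∀ {n} → Fin n → Fin (3 + n)
suc³ a = suc (suc (suc a))

shift₃ : ∀ {n} → Edge (K n) → Edge (K (3 + n))
shift₃ (a , b , a<b , _) = (suc³ a — suc³ b) {fromWitness (s≤s (s≤s (s≤s a<b)))}

determiningEdges : ∀ k → List (Edge (K (3 + k)))
determiningEdges 0 = 0F — 1F ∷ 1F — 2F ∷ []
determiningEdges 1 = 0F — 1F ∷ 1F — 2F ∷ []
determiningEdges 2 = 0F — 1F ∷ 1F — 2F ∷ 2F — 3F ∷ []
determiningEdges (suc (suc (suc k))) = 0F — 1F ∷ 1F — 2F ∷ map shift₃ (determiningEdges k)

[6+m]/3≡2+m/3 : ∀ m → (6 + m) / 3 ≡ 2 + m / 3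
[6+m]/3≡2+m/3 m = +-distrib-/-∣ˡ {6} m {3} (divides 2 refl)

length-determiningEdges : ∀ k → length (determiningEdges k) ≡ (2 * (3 + k)) / 3
length-determiningEdges 0 = refl
length-determiningEdges 1 = refl
length-determiningEdges 2 = refl
length-determiningEdges (suc (suc (suc k))) = begin
  2 + length (map shift₃ (determiningEdges k)) ≡⟨ cong (2 +_) (length-map shift₃ (determiningEdges k)) ⟩
  2 + length (determiningEdges k)              ≡⟨ cong (2 +_) (length-determiningEdges k) ⟩
  2 + (2 * (3 + k)) / 3                        ≡⟨ [6+m]/3≡2+m/3 (2 * (3 + k)) ⟨
  (6 + 2 * (3 + k)) / 3                        ≡⟨ /-congˡ {o = 3} (ℕ.*-distribˡ-+ 2 3 (3 + k)) ⟨
  (2 * (6 + k)) / 3                            ∎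
  where open ≡-Reasoning

suc³-pair : ∀ {n} → Fin n × Fin n → Fin (3 + n) × Fin (3 + n)
suc³-pair (a , b) = suc³ a , suc³ b

suc³-pair-injective : ∀ {n} → Injective _≡_ _≡_ (suc³-pair {n})
suc³-pair-injective {x = _ , _} {y = _ , _} refl = refl

endpoints-shift₃ : ∀ {n} (L : List (Edge (K n))) →
                   map endpoints (map shift₃ L) ≡ map suc³-pair (map endpoints L)
endpoints-shift₃ L = trans (sym (map-∘ L)) (map-∘ L)

determiningEdges-unique : ∀ k → Unique (map (endpoints {G = K (3 + k)}) (determiningEdges k))
determiningEdges-unique 0 = ((λ ()) ∷ []) ∷ [] ∷ []
determiningEdges-unique 1 = ((λ ()) ∷ []) ∷ [] ∷ []
determiningEdges-unique 2 = ((λ ()) ∷ (λ ()) ∷ []) ∷ ((λ ()) ∷ []) ∷ [] ∷ []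
determiningEdges-unique (suc (suc (suc k))) =
  ((λ ()) ∷ avoids-shifted (λ _ ())) ∷ avoids-shifted (λ _ ()) ∷
  subst Unique (sym (endpoints-shift₃ (determiningEdges k)))
        (Unique-map⁺ suc³-pair-injective (determiningEdges-unique k))
  where
  avoids-shifted : ∀ {a b} → (∀ x → a ≢ suc³ x) →
                   All ((a , b) ≢_) (map endpoints (map shift₃ (determiningEdges k)))
  avoids-shifted a∉ = All-map⁺ (All-map⁺ (universal (λ e → a∉ _ ∘ cong proj₁) _))

first-two-edges : ∀ k → 0F — 1F ∈ determiningEdges k × 1F — 2F ∈ determiningEdges k
first-two-edges 0 = here refl , there (here refl)
first-two-edges 1 = here refl , there (here refl)
first-two-edges 2 = here refl , there (here refl)
first-two-edges (suc (suc (suc k))) = here refl , there (here refl)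

module _ {n} (f : Fin n → Fin n) where

  FixesImage : ∀ {m} → (Fin m → Fin n) → Edge (K m) → Set
  FixesImage s (a , b , _) = FixesPair f (s a) (s b)

  module _ (k : ℕ) {s : Fin (3 + k) → Fin n} (s-inj : Injective _≡_ _≡_ s)
           (fixes : ∀ e → e ∈ determiningEdges k → FixesImage s e) where

    first-path-fixed : f (s 0F) ≡ s 0F × f (s 1F) ≡ s 1F × f (s 2F) ≡ s 2F
    first-path-fixed =
      path-fixed {f = f} (contraposition s-inj λ ()) (contraposition s-inj λ ())
                 (contraposition s-inj λ ())
                 (fixes _ (proj₁ (first-two-edges k))) (fixes _ (proj₂ (first-two-edges k)))

  -- The injection s lets the recursion run on the shifted copy inside determiningEdges (3 + k).
  fixed-off-last : ∀ k {s : Fin (3 + k) → Fin n} → Injective _≡_ _≡_ s →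
                   (∀ e → e ∈ determiningEdges k → FixesImage s e) →
                   ∀ x → x ≢ fromℕ (2 + k) → f (s x) ≡ s x
  fixed-off-last k s-inj fixes 0F _ = proj₁ (first-path-fixed k s-inj fixes)
  fixed-off-last k s-inj fixes 1F _ = proj₁ (proj₂ (first-path-fixed k s-inj fixes))
  fixed-off-last k s-inj fixes 2F _ = proj₂ (proj₂ (first-path-fixed k s-inj fixes))
  fixed-off-last 1 s-inj fixes 3F x≢last = ⊥-elim (x≢last refl)
  fixed-off-last 2 s-inj fixes 3F _ =
    fixesPair-right {f = f} (contraposition s-inj λ ()) (fixes _ (there (there (here refl))))
                    (proj₂ (proj₂ (first-path-fixed 2 s-inj fixes)))
  fixed-off-last 2 s-inj fixes 4F x≢last = ⊥-elim (x≢last refl)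
  fixed-off-last (suc (suc (suc k))) {s} s-inj fixes (suc (suc (suc x))) x≢last =
    fixed-off-last k {s ∘ suc³} (suc-injective ∘ suc-injective ∘ suc-injective ∘ s-inj)
      (λ e e∈ → fixes (shift₃ e) (there (there (∈-map⁺ shift₃ e∈))))
      x (x≢last ∘ cong suc³)

determiningEdges-determining : ∀ k → IsEdgeDeterminingSet (K (3 + k)) (determiningEdges k)
determiningEdges-determining k φ _ fixes =
  fixed-everywhere φ (fromℕ (2 + k)) (fixed-off-last (φ ⟨$⟩ʳ_) k id fixes)

theorem8 : ∀ (n : ℕ) → 2 < n → Det′ (K n) ((2 * n) / 3)
theorem8 (suc (suc (suc k))) (s≤s (s≤s (s≤s _))) =
  ((determiningEdges k , determiningEdges-unique k) ,
   determiningEdges-determining k , length-determiningEdges k) ,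
  λ T T-determining → LowerBound.size-bound (proj₁ T) T-determining
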